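{- For any integer $c>1$, the family $\{(F_N,\emptyset)\}_{N>c}$, where $F_N$ is the star with $N$ leaves, is a $c$-closed polynomial pattern family.
   Context: A graph is $c$-closed if any two distinct non-adjacent vertices have fewer than $c$ common neighbours. Given $H$ with $V(H)=\{1,\dots,k\}$ and $U\subseteq V(H)$, a $U$-clique prescribed blow-up of $H$ is a graph whose vertex set is partitioned into nonempty sets $V_1\sqcup\dots\sqcup V_k$ with $V_i$ complete to $V_j$ whenever $ij\in E(H)$ and $V_i$ a clique for $i\in U$ (for $U=\emptyset$ there is no clique condition). $G[S]$ is a maximal such blow-up if it is one and no $S'\supsetneq S$ in $V(G)$ has $G[S']$ one. A family $\{(H_i,U_i)\}$ is a $c$-closed polynomial pattern family if there is a polynomial $f\in\mathbb{R}[x]$ such that for every $c$-closed graph $G$ on $n$ vertices and every member $(H_i,U_i)$, the number of $S\subseteq V(G)$ with $G[S]$ a maximal $U_i$-clique prescribed blow-up of $H_i$ is at most $f(n)$. -}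

module Defs where

open import Data.Nat as ℕ using (ℕ; zero; suc; _<_)
open import Data.Fin using (Fin; zero; suc)
open import Data.Fin.Subset using (Subset; _∈_; _⊂_)
open import Data.List using (List; []; _∷_; length)
open import Data.List.Relation.Unary.All using (All)
open import Data.List.Relation.Unary.Unique.Propositional using (Unique)
open import Data.Product using (Σ; ∃; _×_; _,_)
open import Data.Empty using (⊥)
open import Data.Unit using (⊤)
open import Data.Integer using (+_)
open import Data.Rational as ℚ using (ℚ; _/_; 0ℚ)
open import Relation.Binary.PropositionalEquality using (_≡_; _≢_)
open import Relation.Nullary using (¬_)

record Graph (n : ℕ) : Set₁ where
  field
    Adj    : Fin n → Fin n → Set
    sym    : ∀ {u v} → Adj u v → Adj v u
    irrefl : ∀ {u} → ¬ Adj u u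
open Graph public

-- "the number of elements of type A satisfying P is less than m":
-- every duplicate-free list of such elements has length < m.
CountLt : {A : Set} → (A → Set) → ℕ → Set
CountLt {A} P m = (xs : List A) → Unique xs → All P xs → length xs < m

CountLeℚ : {A : Set} → (A → Set) → ℚ → Set
CountLeℚ {A} P q = (xs : List A) → Unique xs → All P xs → (+ length xs / 1) ℚ.≤ q

CClosed : ∀ {n} → ℕ → Graph n → Set
CClosed {n} c G = (u v : Fin n) → u ≢ v → ¬ Adj G u v →
  CountLt (λ w → Adj G u w × Adj G v w) c

-- G[S] is a U-clique prescribed blow-up of H (V(H) = Fin k):
-- S is partitioned by φ into nonempty parts V_i = {v ∈ S | φ v ≡ i}.
IsBlowUp : ∀ {n k} → Graph n → Graph k → Subset k → Subset n → Set
IsBlowUp {n} {k} G H U S = Σ (Fin n → Fin k) λ φ →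
    ((i : Fin k) → ∃ λ v → v ∈ S × φ v ≡ i)
  × ((u v : Fin n) → u ∈ S → v ∈ S → Adj H (φ u) (φ v) → Adj G u v)
  × ((u v : Fin n) → u ∈ S → v ∈ S → u ≢ v → φ u ≡ φ v → φ u ∈ U → Adj G u v)

IsMaximalBlowUp : ∀ {n k} → Graph n → Graph k → Subset k → Subset n → Set
IsMaximalBlowUp G H U S =
  IsBlowUp G H U S × ((S' : Subset _) → S ⊂ S' → ¬ IsBlowUp G H U S')

-- Polynomials with rational coefficients, coefficient list in increasing degree.
Poly : Set
Poly = List ℚ

eval : Poly → ℚ → ℚ
eval []       x = 0ℚ
eval (a ∷ as) x = a ℚ.+ x ℚ.* eval as x

-- The star F_N with N leaves: vertex set Fin (suc N), centre zero, leaves suc i.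
StarAdj : ∀ {N} → Fin (suc N) → Fin (suc N) → Set
StarAdj zero    zero    = ⊥
StarAdj zero    (suc _) = ⊤
StarAdj (suc _) zero    = ⊤
StarAdj (suc _) (suc _) = ⊥

star : (N : ℕ) → Graph (suc N)
star N = record { Adj = StarAdj ; sym = s ; irrefl = i }
  where
    s : ∀ {u v} → StarAdj {N} u v → StarAdj v u
    s {zero} {suc _} p = _
    s {suc _} {zero} p = _
    i : ∀ {u} → ¬ StarAdj {N} u u
    i {zero} ()
    i {suc _} ()

-- Let G[S] be a maximal blow-up of the star F_N, N > c, with centre part A and
-- leaf parts B_1, …, B_N. Any two vertices of A have the N > c leaf
-- representatives as common neighbours, so by c-closedness A is a clique; hence
-- every vertex of S is adjacent to every other vertex of A. Let T consist of
-- min(c, |A|) vertices of A. Then S = T ∪ N(T), where N(T) is the common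
-- neighbourhood of T: a vertex v ∉ S adjacent to all of T is adjacent to all
-- of A (either T = A, or v and a ∈ A ∖ T have the c common neighbours T), so v
-- could be added to a leaf part, contradicting maximality. Thus S is determined
-- by a list of at most c vertices, and there are at most 1 + n + ⋯ + n^c such.
module Submission where

open import Defs hiding (sym)
open import Data.Nat using (ℕ; _<_)
open import Data.Fin.Subset using (Subset; ⊥)
open import Data.Product using (Σ)
open import Data.Integer using (+_)
open import Data.Rational using (_/_)

open import Level using (Level)
open import Function using (_∘_; case_of_)
open import Data.Nat as ℕ using (zero; suc; _≤_; z≤n; s≤s)
import Data.Nat.Properties as ℕ
import Data.Integer as ℤ
import Data.Integer.Properties as ℤ
open import Data.Rational as ℚ using (ℚ; 1ℚ)
import Data.Rational.Properties as ℚ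
open import Data.Nat.Coprimality using (1-coprimeTo) renaming (sym to coprime-sym)
open import Data.Fin as Fin using (Fin; zero; suc)
import Data.Fin.Properties as Fin
open import Data.Fin.Subset using (_∪_; ⁅_⁆; _⊆_) renaming (_∈_ to _∈ₛ_; _∉_ to _∉ₛ_)
open import Data.Fin.Subset.Properties
  using (⊆-antisym; p⊆p∪q; x∈p∪q⁺; x∈p∪q⁻; x∈⁅x⁆; x∈⁅y⁆⇒x≡y; ∉⊥) renaming (_∈?_ to _∈ₛ?_)
open import Data.Vec using (tabulate)
open import Data.Vec.Properties using (lookup∘tabulate; []=⇒lookup; lookup⇒[]=)
open import Data.List
  using (List; []; _∷_; _++_; length; allFin; filter; take; map; replicate; cartesianProductWith)
open import Data.List.Properties using (length-map; length-tabulate; length-++; length-take)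
open import Data.List.Membership.Propositional using (_∈_)
open import Data.List.Membership.Propositional.Properties
  using (∈-allFin; ∈-filter⁺; ∈-map⁺; ∈-map⁻; ∈-∃++; ∈-++⁻; ∈-++⁺ˡ; ∈-++⁺ʳ; ∈-cartesianProductWith⁺)
import Data.List.Membership.DecPropositional as DecMembership
open import Data.List.Relation.Binary.Subset.Propositional using () renaming (_⊆_ to _⊆ₗ_)
open import Data.List.Relation.Unary.Any using (here; there)
open import Data.List.Relation.Unary.All as All using (All; all?)
open import Data.List.Relation.Unary.All.Properties using (all-filter) renaming (take⁺ to All-take⁺)
open import Data.List.Relation.Unary.Unique.Propositional using (Unique)
open import Data.List.Relation.Unary.Unique.Propositional.Properties
  using (allFin⁺; filter⁺; take⁺; Unique[x∷xs]⇒x∉xs) renaming (map⁺ to Unique-map⁺)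
open import Data.List.Relation.Unary.AllPairs using (_∷_)
open import Data.Sum using (_⊎_; inj₁; inj₂)
open import Data.Product using (_×_; _,_; proj₁; proj₂)
open import Data.Unit using (tt)
open import Data.Bool using (true)
open import Relation.Binary.PropositionalEquality
open import Relation.Unary using (Pred; Decidable)
open import Relation.Nullary using (¬_; Dec; yes; no; does; contradiction; _×-dec_; _⊎-dec_)
open import Relation.Nullary.Decidable using (dec-true; decidable-stable; ¬¬-excluded-middle)
open import Relation.Nullary.Negation using (¬¬-map)

private
  variable
    ℓ : Level
    A : Set
    k n : ℕ

toℚ : ℕ → ℚ
toℚ m = + m / 1

toℚ≡mkℚ : ∀ m → toℚ m ≡ ℚ.mkℚ (+ m) 0 (coprime-sym (1-coprimeTo m))
toℚ≡mkℚ m = ℚ.normalize-coprime _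

toℚ-+ : ∀ a b → toℚ a ℚ.+ toℚ b ≡ toℚ (a ℕ.+ b)
toℚ-+ a b = trans (cong₂ ℚ._+_ (toℚ≡mkℚ a) (toℚ≡mkℚ b))
  (cong (_/ 1) (cong₂ ℤ._+_ (ℤ.*-identityʳ (+ a)) (ℤ.*-identityʳ (+ b))))

toℚ-* : ∀ a b → toℚ a ℚ.* toℚ b ≡ toℚ (a ℕ.* b)
toℚ-* a b = trans (cong₂ ℚ._*_ (toℚ≡mkℚ a) (toℚ≡mkℚ b)) (cong (_/ 1) (sym (ℤ.pos-* a b)))

toℚ-mono-≤ : ∀ {a b} → a ≤ b → toℚ a ℚ.≤ toℚ b
toℚ-mono-≤ {a} {b} a≤b rewrite toℚ≡mkℚ a | toℚ≡mkℚ b =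
  ℚ.*≤* (ℤ.*-monoʳ-≤-nonNeg (+ 1) (ℤ.+≤+ a≤b))

geometricSum : ℕ → ℕ → ℕ
geometricSum x zero    = 0
geometricSum x (suc k) = suc (x ℕ.* geometricSum x k)

eval-replicate-1ℚ : ∀ x k → eval (replicate k 1ℚ) (toℚ x) ≡ toℚ (geometricSum x k)
eval-replicate-1ℚ x zero    = refl
eval-replicate-1ℚ x (suc k) = begin
  1ℚ ℚ.+ toℚ x ℚ.* eval (replicate k 1ℚ) (toℚ x) ≡⟨ cong (λ q → 1ℚ ℚ.+ toℚ x ℚ.* q) (eval-replicate-1ℚ x k) ⟩
  1ℚ ℚ.+ toℚ x ℚ.* toℚ (geometricSum x k)         ≡⟨ cong (1ℚ ℚ.+_) (toℚ-* x (geometricSum x k)) ⟩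
  toℚ 1 ℚ.+ toℚ (x ℕ.* geometricSum x k)         ≡⟨ toℚ-+ 1 (x ℕ.* geometricSum x k) ⟩
  toℚ (geometricSum x (suc k))                    ∎
  where open ≡-Reasoning

Unique-⊆⇒length≤ : {xs ys : List A} → Unique xs → xs ⊆ₗ ys → length xs ≤ length ys
Unique-⊆⇒length≤ {xs = []}     _           _     = z≤n
Unique-⊆⇒length≤ {xs = x ∷ xs} u@(_ ∷ uxs) xs⊆ys with ∈-∃++ (xs⊆ys (here refl))
... | us , zs , refl = begin
  suc (length xs)               ≤⟨ s≤s (Unique-⊆⇒length≤ uxs xs⊆us++zs) ⟩
  suc (length (us ++ zs))       ≡⟨ cong suc (length-++ us) ⟩
  suc (length us ℕ.+ length zs) ≡⟨ ℕ.+-suc (length us) (length zs) ⟨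
  length us ℕ.+ suc (length zs) ≡⟨ length-++ us ⟨
  length (us ++ x ∷ zs)         ∎
  where
  open ℕ.≤-Reasoning
  xs⊆us++zs : xs ⊆ₗ us ++ zs
  xs⊆us++zs y∈xs with ∈-++⁻ us (xs⊆ys (there y∈xs))
  ... | inj₁ y∈us         = ∈-++⁺ˡ y∈us
  ... | inj₂ (here refl)  = contradiction y∈xs (Unique[x∷xs]⇒x∉xs u)
  ... | inj₂ (there y∈zs) = ∈-++⁺ʳ us y∈zs

length-cartesianProductWith : ∀ {B C : Set} (f : A → B → C) xs ys →
  length (cartesianProductWith f xs ys) ≡ length xs ℕ.* length ys
length-cartesianProductWith f []       ys = refl
length-cartesianProductWith f (x ∷ xs) ys = begin
  length (map (f x) ys ++ cartesianProductWith f xs ys)     ≡⟨ length-++ (map (f x) ys) ⟩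
  length (map (f x) ys) ℕ.+ length (cartesianProductWith f xs ys)
    ≡⟨ cong₂ ℕ._+_ (length-map (f x) ys) (length-cartesianProductWith f xs ys) ⟩
  length ys ℕ.+ length xs ℕ.* length ys                     ∎
  where open ≡-Reasoning

listsShorterThan : (n k : ℕ) → List (List (Fin n))
listsShorterThan n zero    = []
listsShorterThan n (suc k) = [] ∷ cartesianProductWith _∷_ (allFin n) (listsShorterThan n k)

length-listsShorterThan : ∀ n k → length (listsShorterThan n k) ≡ geometricSum n k
length-listsShorterThan n zero    = refl
length-listsShorterThan n (suc k) = cong suc (begin
  length (cartesianProductWith _∷_ (allFin n) (listsShorterThan n k))
    ≡⟨ length-cartesianProductWith _∷_ (allFin n) (listsShorterThan n k) ⟩
  length (allFin n) ℕ.* length (listsShorterThan n k)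
    ≡⟨ cong₂ ℕ._*_ (length-tabulate {n = n} (λ i → i)) (length-listsShorterThan n k) ⟩
  n ℕ.* geometricSum n k ∎)
  where open ≡-Reasoning

∈-listsShorterThan : (L : List (Fin n)) → length L < k → L ∈ listsShorterThan n k
∈-listsShorterThan []      (s≤s _)   = here refl
∈-listsShorterThan (v ∷ L) (s≤s L<k) =
  there (∈-cartesianProductWith⁺ _∷_ (∈-allFin v) (∈-listsShorterThan L L<k))

∈-take⊎length-take≡ : ∀ k {x} {xs : List A} → x ∈ xs → x ∈ take k xs ⊎ length (take k xs) ≡ k
∈-take⊎length-take≡ zero    _         = inj₂ refl
∈-take⊎length-take≡ (suc k) (here p)  = inj₁ (here p)
∈-take⊎length-take≡ (suc k) (there p) with ∈-take⊎length-take≡ k p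
... | inj₁ x∈ = inj₁ (there x∈)
... | inj₂ eq = inj₂ (cong suc eq)

length-take≤ : ∀ k (xs : List A) → length (take k xs) ≤ k
length-take≤ k xs = ℕ.≤-trans (ℕ.≤-reflexive (length-take k xs)) (ℕ.m⊓n≤m k _)

select : {P : Pred (Fin n) ℓ} → Decidable P → Subset n
select P? = tabulate (does ∘ P?)

module _ {P : Pred (Fin n) ℓ} (P? : Decidable P) where

  ∈-select⁺ : ∀ {x} → P x → x ∈ₛ select P?
  ∈-select⁺ {x} px = lookup⇒[]= x _ (trans (lookup∘tabulate (does ∘ P?) x) (dec-true (P? x) px))

  ∈-select⁻ : ∀ {x} → x ∈ₛ select P? → P x
  ∈-select⁻ {x} x∈ = witness (P? x) (trans (sym (lookup∘tabulate (does ∘ P?) x)) ([]=⇒lookup x∈))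
    where
    witness : (d : Dec (P x)) → does d ≡ true → P x
    witness (yes px) _ = px

¬¬-Π-Fin : {P : Fin n → Set ℓ} → (∀ i → ¬ ¬ P i) → ¬ ¬ (∀ i → P i)
¬¬-Π-Fin {n = zero}      _  k = k (λ ())
¬¬-Π-Fin {n = suc n} {P = P} ¬¬P k =
  ¬¬P zero λ p₀ → ¬¬-Π-Fin (¬¬P ∘ suc) λ pₛ → k λ { zero → p₀ ; (suc i) → pₛ i }

¬¬-Adj-decidable : (G : Graph n) → ¬ ¬ (∀ u v → Dec (Adj G u v))
¬¬-Adj-decidable G = ¬¬-Π-Fin λ u → ¬¬-Π-Fin λ v → ¬¬-excluded-middle

leaf⇒centre : ∀ {N} {i : Fin N} x → StarAdj (suc i) x → x ≡ zero
leaf⇒centre zero    _ = refl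
leaf⇒centre (suc x) ()

module _ {n} (G : Graph n) (adj? : ∀ u v → Dec (Adj G u v)) where

  open DecMembership (Fin._≟_ {n}) using (_∈?_)

  CommonNeighbour : List (Fin n) → Pred (Fin n) _
  CommonNeighbour T v = All (λ t → Adj G t v) T

  ∈⊎CommonNeighbour? : ∀ T → Decidable (λ v → v ∈ T ⊎ CommonNeighbour T v)
  ∈⊎CommonNeighbour? T v = (v ∈? T) ⊎-dec all? (λ t → adj? t v) T

  closure : List (Fin n) → Subset n
  closure T = select (∈⊎CommonNeighbour? T)

  CClosed⇒Adj : ∀ {c u v} → CClosed c G → u ≢ v → (ws : List (Fin n)) → Unique ws →
    c ≤ length ws → All (λ w → Adj G u w × Adj G v w) ws → Adj G u v
  CClosed⇒Adj {u = u} {v} cc u≢v ws uws c≤ws common with adj? u v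
  ... | yes uv = uv
  ... | no ¬uv = contradiction (cc u v u≢v ¬uv ws uws common) (ℕ.≤⇒≯ c≤ws)

  module StarBlowUp {N} {S : Subset n} (blowUp : IsBlowUp G (star N) ⊥ S) where

    φ : Fin n → Fin (suc N)
    φ = proj₁ blowUp

    private
      parts-nonempty = proj₁ (proj₂ blowUp)
      complete       = proj₁ (proj₂ (proj₂ blowUp))

    Centre : Pred (Fin n) _
    Centre v = v ∈ₛ S × φ v ≡ zero

    centre? : Decidable Centre
    centre? v = (v ∈ₛ? S) ×-dec (φ v Fin.≟ zero)

    centre-adj-leaf : ∀ {a w j} → Centre a → w ∈ₛ S → φ w ≡ suc j → Adj G a w
    centre-adj-leaf {a} {w} (a∈S , φa≡0) w∈S φw≡j =
      complete a w a∈S w∈S (subst₂ StarAdj (sym φa≡0) (sym φw≡j) tt)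

    leaf : Fin N → Fin n
    leaf i = proj₁ (parts-nonempty (suc i))

    leaf∈S : ∀ i → leaf i ∈ₛ S
    leaf∈S i = proj₁ (proj₂ (parts-nonempty (suc i)))

    φ-leaf : ∀ i → φ (leaf i) ≡ suc i
    φ-leaf i = proj₂ (proj₂ (parts-nonempty (suc i)))

    leaf-injective : ∀ {i j} → leaf i ≡ leaf j → i ≡ j
    leaf-injective {i} {j} eq = Fin.suc-injective (trans (sym (φ-leaf i)) (trans (cong φ eq) (φ-leaf j)))

    centre-clique : ∀ {c a a′} → CClosed c G → c ≤ N → Centre a → Centre a′ → a ≢ a′ → Adj G a a′
    centre-clique cc c≤N ca ca′ a≢a′ =
      CClosed⇒Adj cc a≢a′ leaves (Unique-map⁺ leaf-injective (allFin⁺ N)) c≤leaves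
        (All.tabulate λ w∈ → case ∈-map⁻ leaf w∈ of λ where
          (i , _ , refl) → centre-adj-leaf ca (leaf∈S i) (φ-leaf i) , centre-adj-leaf ca′ (leaf∈S i) (φ-leaf i))
      where
      leaves = map leaf (allFin N)
      c≤leaves = subst (_ ≤_) (sym (trans (length-map leaf (allFin N)) (length-tabulate (λ i → i)))) c≤N

    centre-adj : ∀ {c a v} → CClosed c G → c ≤ N → Centre a → v ∈ₛ S → a ≢ v → Adj G a v
    centre-adj {v = v} cc c≤N ca v∈S a≢v with φ v in φv
    ... | zero  = centre-clique cc c≤N ca (v∈S , φv) a≢v
    ... | suc j = centre-adj-leaf ca v∈S φv

    module _ (j : Fin N) {v} (v∉S : v ∉ₛ S) (adj : ∀ {a} → Centre a → Adj G a v) where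

      private
        φ′ : Fin n → Fin (suc N)
        φ′ u with u Fin.≟ v
        ... | yes _ = suc j
        ... | no  _ = φ u

        φ′-v : φ′ v ≡ suc j
        φ′-v with v Fin.≟ v
        ... | yes _   = refl
        ... | no  v≢v = contradiction refl v≢v

        φ′-old : ∀ {u} → u ≢ v → φ′ u ≡ φ u
        φ′-old {u} u≢v with u Fin.≟ v
        ... | yes u≡v = contradiction u≡v u≢v
        ... | no  _   = refl

        ∈S⇒≢v : ∀ {u} → u ∈ₛ S → u ≢ v
        ∈S⇒≢v u∈S refl = v∉S u∈S

        old∈S : ∀ {u} → u ∈ₛ S ∪ ⁅ v ⁆ → u ≢ v → u ∈ₛ S
        old∈S {u} u∈ u≢v with x∈p∪q⁻ S ⁅ v ⁆ u∈
        ... | inj₁ u∈S = u∈S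
        ... | inj₂ u∈v = contradiction (x∈⁅y⁆⇒x≡y v u∈v) u≢v

        complete′ : ∀ u w → u ∈ₛ S ∪ ⁅ v ⁆ → w ∈ₛ S ∪ ⁅ v ⁆ → StarAdj (φ′ u) (φ′ w) → Adj G u w
        complete′ u w u∈ w∈ = go (u Fin.≟ v) (w Fin.≟ v)
          where
          go : Dec (u ≡ v) → Dec (w ≡ v) → StarAdj (φ′ u) (φ′ w) → Adj G u w
          go (yes refl) (yes refl) p = contradiction (subst₂ StarAdj φ′-v φ′-v p) λ ()
          go (yes refl) (no w≢v)   p = Graph.sym G (adj (old∈S w∈ w≢v ,
            leaf⇒centre (φ w) (subst₂ StarAdj φ′-v (φ′-old w≢v) p)))
          go (no u≢v)   (yes refl) p = adj (old∈S u∈ u≢v ,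
            leaf⇒centre (φ u) (subst₂ StarAdj φ′-v (φ′-old u≢v) (Graph.sym (star N) p)))
          go (no u≢v)   (no w≢v)   p =
            complete u w (old∈S u∈ u≢v) (old∈S w∈ w≢v) (subst₂ StarAdj (φ′-old u≢v) (φ′-old w≢v) p)

      addToLeafPart : IsBlowUp G (star N) ⊥ (S ∪ ⁅ v ⁆)
      addToLeafPart = φ′
        , (λ i → let (w , w∈S , φw) = parts-nonempty i in
                 w , p⊆p∪q ⁅ v ⁆ w∈S , trans (φ′-old (∈S⇒≢v w∈S)) φw)
        , complete′
        , λ _ _ _ _ _ _ i∈⊥ → contradiction i∈⊥ ∉⊥

  module MaximalStarBlowUp {c N} (cc : CClosed c G) (c<N : c < N) {S : Subset n}
                           (maximal : IsMaximalBlowUp G (star N) ⊥ S) where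

    open StarBlowUp (proj₁ maximal)

    centreList : List (Fin n)
    centreList = filter centre? (allFin n)

    T : List (Fin n)
    T = take c centreList

    private
      c≤N = ℕ.<⇒≤ c<N

      T-centre : All Centre T
      T-centre = All-take⁺ c (all-filter centre? (allFin n))

      S⊆closure : S ⊆ closure T
      S⊆closure {v} v∈S with v ∈? T
      ... | yes v∈T = ∈-select⁺ (∈⊎CommonNeighbour? T) (inj₁ v∈T)
      ... | no  v∉T = ∈-select⁺ (∈⊎CommonNeighbour? T) (inj₂ (All.tabulate λ t∈T →
        centre-adj cc c≤N (All.lookup T-centre t∈T) v∈S λ { refl → v∉T t∈T }))

      common⇒adj-centre : ∀ {v} → v ∉ₛ S → CommonNeighbour T v → ∀ {a} → Centre a → Adj G a v
      common⇒adj-centre {v} v∉S common {a} ca@(a∈S , _) with a ∈? T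
      ... | yes a∈T = All.lookup common a∈T
      ... | no  a∉T with ∈-take⊎length-take≡ c (∈-filter⁺ centre? (∈-allFin a) ca)
      ...   | inj₁ a∈T   = contradiction a∈T a∉T
      ...   | inj₂ |T|≡c = CClosed⇒Adj cc (λ { refl → v∉S a∈S }) T
          (take⁺ c (filter⁺ centre? (allFin⁺ n))) (ℕ.≤-reflexive (sym |T|≡c))
          (All.tabulate λ t∈T →
            centre-adj cc c≤N ca (proj₁ (All.lookup T-centre t∈T)) (λ { refl → a∉T t∈T })
            , Graph.sym G (All.lookup common t∈T))

      closure⊆S : closure T ⊆ S
      closure⊆S {v} v∈ with ∈-select⁻ (∈⊎CommonNeighbour? T) v∈ | v ∈ₛ? S
      ... | inj₁ v∈T    | _        = proj₁ (All.lookup T-centre v∈T)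
      ... | inj₂ _      | yes v∈S  = v∈S
      ... | inj₂ common | no  v∉S  =
        contradiction (addToLeafPart someLeaf v∉S (common⇒adj-centre v∉S common))
          (proj₂ maximal (S ∪ ⁅ v ⁆) (p⊆p∪q ⁅ v ⁆ , v , x∈p∪q⁺ (inj₂ (x∈⁅x⁆ v)) , v∉S))
        where someLeaf = Fin.fromℕ< (ℕ.≤-<-trans z≤n c<N)

    S≡closure : S ≡ closure T
    S≡closure = ⊆-antisym S⊆closure closure⊆S

    length-T≤ : length T ≤ c
    length-T≤ = length-take≤ c centreList

  maximalStarBlowUps-length≤ : ∀ {c N} → CClosed c G → c < N →
    (Ss : List (Subset n)) → Unique Ss → All (IsMaximalBlowUp G (star N) ⊥) Ss →
    length Ss ≤ geometricSum n (suc c)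
  maximalStarBlowUps-length≤ {c} cc c<N Ss uSs maximal = begin
    length Ss                                          ≤⟨ Unique-⊆⇒length≤ uSs Ss⊆closures ⟩
    length (map closure (listsShorterThan n (suc c)))  ≡⟨ length-map closure (listsShorterThan n (suc c)) ⟩
    length (listsShorterThan n (suc c))                ≡⟨ length-listsShorterThan n (suc c) ⟩
    geometricSum n (suc c)                             ∎
    where
    open ℕ.≤-Reasoning
    Ss⊆closures : Ss ⊆ₗ map closure (listsShorterThan n (suc c))
    Ss⊆closures S∈Ss = subst (_∈ map closure (listsShorterThan n (suc c))) (sym S≡closure)
      (∈-map⁺ closure (∈-listsShorterThan T (s≤s length-T≤)))
      where open MaximalStarBlowUp cc c<N (All.lookup maximal S∈Ss)

-- Adjacency in G need not be decidable, but the conclusion is a decidable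
-- inequality of rationals, so it suffices to prove it under ¬ ¬-decidability.
corollary3 : (c : ℕ) → 1 < c →
    Σ Poly λ f → (N : ℕ) → c < N → (n : ℕ) → (G : Graph n) → CClosed c G →
    CountLeℚ (λ (S : Subset n) → IsMaximalBlowUp G (star N) ⊥ S) (eval f (+ n / 1))
corollary3 c _ = replicate (suc c) 1ℚ , λ N c<N n G cc Ss uSs maximal →
  decidable-stable (toℚ (length Ss) ℚ.≤? eval (replicate (suc c) 1ℚ) (toℚ n))
    (¬¬-map (λ adj? → subst (toℚ (length Ss) ℚ.≤_) (sym (eval-replicate-1ℚ n (suc c)))
                        (toℚ-mono-≤ (maximalStarBlowUps-length≤ G adj? cc c<N Ss uSs maximal)))
            (¬¬-Adj-decidable G))
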